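{- Let $p$ be a predicate of arity $k$, let $\bar y=y_1\dots y_k$ be distinct individual symbols not in $\mathcal X$, let $\bar x=x_1\dots x_k$, and let $A=A(\bar x)$, $B=B(\bar x)$ be formulas. Let \[F=\forall\bar y\,(A(\bar y)\rightarrow p(\bar y))\wedge\forall\bar y\,(p(\bar y)\rightarrow B(\bar y)),\] and let $\langle F[p],t\rangle$ be a unary reproductive solution problem that has a solution. Assume $\mathrm{SUBST}(A(\bar x),p,F)$, $\mathrm{SUBST}(B(\bar x),p,F)$ and $\mathrm{SUBST}(t(\bar x),p,F)$. Then the clean variant of $A(\bar x)\vee(B(\bar x)\wedge t(\bar x))$ is a reproductive solution of $\langle F[p],t\rangle$.
   Context: Formulas are those of first-order logic with equality extended by second-order quantification over predicates. $\mathrm{free}(F)$ is the set of symbols occurring free in $F$. $\mathrm{clean}(F)$: no member of $\mathrm{free}(F)$ is bound by a quantifier occurrence in $F$. The clean variant of a formula is the (uniquely chosen) formula obtained by renaming bound symbols to fresh ones so that the result is clean. $\models$ denotes validity, $\equiv$ equivalence. $\mathcal X=\{x_1,x_2,\dots\}$ is a fixed set of distinguished individual symbols. Writing a formula as $A(\bar x)$ declares that $A(\bar s)$ denotes $A$ with free occurrences of $x_j$ replaced by $s_j$. Substitution: for a predicate $p$ of arity $k$, $F=F[p]$ and a formula $G$, $F[G]$ is $F$ with each atom occurrence $p(s_1,\dots,s_k)$ with $p$ free in $F$ replaced by $G$ with free $x_1,\dots,x_k$ replaced by $s_1,\dots,s_k$. $\mathrm{SUBST}(G,p,F)$ holds iff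 (i) no free occurrence of $p$ in $F$ is in the scope of a quantifier binding a member of $\mathrm{free}(G)$; (ii) $p\notin\mathrm{free}(G)$; (iii) $\mathrm{free}(G)\cap\{x_j: j>k\}=\emptyset$. A solution of the unary solution problem $F[p]$ is a formula $G$ with $\mathrm{SUBST}(G,p,F)$ and $\models F[G]$. A unary reproductive solution problem $\langle F[p],t\rangle$: $t$ is a predicate of the same arity as $p$ with $t\notin\mathrm{free}(F)\cup\{p\}$. A parametric solution of it is a formula $G[t]$ with $\mathrm{clean}(G)$, $\mathrm{SUBST}(G,p,F)$, and for all $H$ with $\mathrm{SUBST}(H,t,G)$, $\mathrm{SUBST}(H,p,F)$: if some $T$ has $\mathrm{SUBST}(T,t,G)$, $\mathrm{SUBST}(G[T],p,F)$ and $H\equiv G[T]$, then $\models F[H]$. A reproductive solution is a parametric solution $G$ such that for all $H$ with $\mathrm{SUBST}(H,t,G)$ and $\mathrm{SUBST}(H,p,F)$: $\models F[H]$ implies $H\equiv G[H]$. -}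

module Defs where

open import Data.Nat using (ℕ; zero; suc; _≤_; _⊔_; _≟_)
open import Data.Bool using (Bool; true; false; if_then_else_; _∨_)
open import Data.Fin using (Fin; toℕ)
open import Data.Vec using (Vec; []; _∷_; tabulate) renaming (map to vmap)
open import Data.List using (List; []; _∷_)
open import Data.Product using (Σ; _×_; _,_; proj₁)
open import Data.Sum using (_⊎_)
open import Data.Unit using (⊤)
open import Data.Empty using (⊥)
open import Level using (Lift)
open import Relation.Nullary using (¬_; Dec; yes; no)
open import Relation.Nullary.Decidable using (⌊_⌋)
open import Relation.Binary.PropositionalEquality using (_≡_; _≢_; refl)

-- Individual symbols.  xs j is the distinguished symbol x_{j+1} ∈ 𝒳;
-- ys n ranges over the (infinitely many) individual symbols not in 𝒳.
data Ind : Set where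
  xs : ℕ → Ind
  ys : ℕ → Ind

record FSym : Set where
  constructor fsym
  field
    far : ℕ
    fnm : ℕ

record PSym : Set where
  constructor psym
  field
    ar : ℕ
    nm : ℕ

open PSym public

data Sym : Set where
  si : Ind → Sym
  sf : FSym → Sym
  sp : PSym → Sym

_≟I_ : (a b : Ind) → Dec (a ≡ b)
xs m ≟I xs n with m ≟ n
... | yes refl = yes refl
... | no ne = no (λ { refl → ne refl })
xs m ≟I ys n = no (λ ())
ys m ≟I xs n = no (λ ())
ys m ≟I ys n with m ≟ n
... | yes refl = yes refl
... | no ne = no (λ { refl → ne refl })

_≟P_ : (a b : PSym) → Dec (a ≡ b)
psym a m ≟P psym b n with a ≟ b | m ≟ n
... | yes refl | yes refl = yes refl
... | no ne | _ = no (λ { refl → ne refl })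
... | yes _ | no ne = no (λ { refl → ne refl })

data Term : Set where
  var : Ind → Term
  app : (f : FSym) → Vec Term (FSym.far f) → Term

data Quant : Set where
  forallQ existsQ : Quant

data BinOp : Set where
  andOp orOp impOp : BinOp

data Fm : Set where
  top bot : Fm
  atom : (q : PSym) → Vec Term (ar q) → Fm
  equ  : Term → Term → Fm
  neg  : Fm → Fm
  bin  : BinOp → Fm → Fm → Fm
  qi   : Quant → Ind → Fm → Fm
  qp   : Quant → PSym → Fm → Fm

data OccT (s : Sym) : Term → Set
data OccTs (s : Sym) : ∀ {n} → Vec Term n → Set

data OccT s where
  o-var : ∀ {y} → s ≡ si y → OccT s (var y)
  o-fun : ∀ {f ts} → s ≡ sf f → OccT s (app f ts)
  o-arg : ∀ {f ts} → OccTs s ts → OccT s (app f ts)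

data OccTs s where
  o-hd : ∀ {n t} {ts : Vec Term n} → OccT s t → OccTs s (t ∷ ts)
  o-tl : ∀ {n t} {ts : Vec Term n} → OccTs s ts → OccTs s (t ∷ ts)

data FreeIn (s : Sym) : Fm → Set where
  f-pred : ∀ {q ts} → s ≡ sp q → FreeIn s (atom q ts)
  f-arg  : ∀ {q ts} → OccTs s ts → FreeIn s (atom q ts)
  f-eqˡ  : ∀ {t u} → OccT s t → FreeIn s (equ t u)
  f-eqʳ  : ∀ {t u} → OccT s u → FreeIn s (equ t u)
  f-neg  : ∀ {φ} → FreeIn s φ → FreeIn s (neg φ)
  f-binˡ : ∀ {o φ ψ} → FreeIn s φ → FreeIn s (bin o φ ψ)
  f-binʳ : ∀ {o φ ψ} → FreeIn s ψ → FreeIn s (bin o φ ψ)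
  f-qi   : ∀ {Q y φ} → s ≢ si y → FreeIn s φ → FreeIn s (qi Q y φ)
  f-qp   : ∀ {Q q φ} → s ≢ sp q → FreeIn s φ → FreeIn s (qp Q q φ)

data Binds (s : Sym) : Fm → Set where
  b-qi-here  : ∀ {Q y φ} → s ≡ si y → Binds s (qi Q y φ)
  b-qi-there : ∀ {Q y φ} → Binds s φ → Binds s (qi Q y φ)
  b-qp-here  : ∀ {Q q φ} → s ≡ sp q → Binds s (qp Q q φ)
  b-qp-there : ∀ {Q q φ} → Binds s φ → Binds s (qp Q q φ)
  b-neg      : ∀ {φ} → Binds s φ → Binds s (neg φ)
  b-binˡ     : ∀ {o φ ψ} → Binds s φ → Binds s (bin o φ ψ)
  b-binʳ     : ∀ {o φ ψ} → Binds s ψ → Binds s (bin o φ ψ)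

Clean : Fm → Set
Clean F = ∀ s → FreeIn s F → ¬ Binds s F

data FreeUnder (s b : Sym) : Fm → Set where
  u-qi-here  : ∀ {Q y φ} → s ≢ si y → b ≡ si y → FreeIn s φ → FreeUnder s b (qi Q y φ)
  u-qi-there : ∀ {Q y φ} → s ≢ si y → FreeUnder s b φ → FreeUnder s b (qi Q y φ)
  u-qp-here  : ∀ {Q q φ} → s ≢ sp q → b ≡ sp q → FreeIn s φ → FreeUnder s b (qp Q q φ)
  u-qp-there : ∀ {Q q φ} → s ≢ sp q → FreeUnder s b φ → FreeUnder s b (qp Q q φ)
  u-neg      : ∀ {φ} → FreeUnder s b φ → FreeUnder s b (neg φ)
  u-binˡ     : ∀ {o φ ψ} → FreeUnder s b φ → FreeUnder s b (bin o φ ψ)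
  u-binʳ     : ∀ {o φ ψ} → FreeUnder s b ψ → FreeUnder s b (bin o φ ψ)

SUBST : Fm → PSym → Fm → Set
SUBST G p F =
  (∀ b → FreeIn b G → ¬ FreeUnder (sp p) b F)
  × ¬ FreeIn (sp p) G
  × (∀ j → ar p ≤ j → ¬ FreeIn (si (xs j)) G)

yIdx : Ind → ℕ
yIdx (xs _) = 0
yIdx (ys n) = suc n

maxYT : Term → ℕ
maxYTs : ∀ {n} → Vec Term n → ℕ
maxYT (var y) = yIdx y
maxYT (app f ts) = maxYTs ts
maxYTs [] = 0
maxYTs (t ∷ ts) = maxYT t ⊔ maxYTs ts

-- strict upper bound of the indices of all ys-symbols occurring in F
maxY : Fm → ℕ
maxY top = 0
maxY bot = 0
maxY (atom q ts) = maxYTs ts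
maxY (equ t u) = maxYT t ⊔ maxYT u
maxY (neg φ) = maxY φ
maxY (bin o φ ψ) = maxY φ ⊔ maxY ψ
maxY (qi Q y φ) = yIdx y ⊔ maxY φ
maxY (qp Q q φ) = maxY φ

-- strict upper bound of the names of all predicate symbols occurring in F
maxP : Fm → ℕ
maxP top = 0
maxP bot = 0
maxP (atom q ts) = suc (nm q)
maxP (equ t u) = 0
maxP (neg φ) = maxP φ
maxP (bin o φ ψ) = maxP φ ⊔ maxP ψ
maxP (qi Q y φ) = maxP φ
maxP (qp Q q φ) = suc (nm q) ⊔ maxP φ

Sub : Set
Sub = List (Ind × Term)

lookupS : Sub → Ind → Term
lookupS [] y = var y
lookupS ((z , t) ∷ σ) y = if ⌊ z ≟I y ⌋ then t else lookupS σ y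

removeS : Ind → Sub → Sub
removeS y [] = []
removeS y ((z , t) ∷ σ) = if ⌊ z ≟I y ⌋ then removeS y σ else (z , t) ∷ removeS y σ

occTB : Ind → Term → Bool
occTsB : ∀ {n} → Ind → Vec Term n → Bool
occTB y (var z) = ⌊ y ≟I z ⌋
occTB y (app f ts) = occTsB y ts
occTsB y [] = false
occTsB y (t ∷ ts) = occTB y t ∨ occTsB y ts

occS : Ind → Sub → Bool
occS y [] = false
occS y ((z , t) ∷ σ) = occTB y t ∨ occS y σ

maxYS : Sub → ℕ
maxYS [] = 0
maxYS ((z , t) ∷ σ) = yIdx z ⊔ maxYT t ⊔ maxYS σ

substT : Sub → Term → Term
substTs : ∀ {n} → Sub → Vec Term n → Vec Term n
substT σ (var y) = lookupS σ y
substT σ (app f ts) = app f (substTs σ ts)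
substTs σ [] = []
substTs σ (t ∷ ts) = substT σ t ∷ substTs σ ts

-- at an individual binder y whose name would capture a variable of the
-- substituted terms, y is renamed to a fresh symbol
substF : Sub → Fm → Fm
substF σ top = top
substF σ bot = bot
substF σ (atom q ts) = atom q (substTs σ ts)
substF σ (equ t u) = equ (substT σ t) (substT σ u)
substF σ (neg φ) = neg (substF σ φ)
substF σ (bin o φ ψ) = bin o (substF σ φ) (substF σ ψ)
substF σ (qi Q y φ) =
  let σ' = removeS y σ
      y' = ys (maxYS σ' ⊔ maxY φ)
  in if occS y σ'
     then qi Q y' (substF ((y , var y') ∷ σ') φ)
     else qi Q y (substF σ' φ)
substF σ (qp Q q φ) = qp Q q (substF σ φ)

xsub : ∀ {k} → ℕ → Vec Term k → Sub
xsub j [] = []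
xsub j (t ∷ ts) = (xs j , t) ∷ xsub (suc j) ts

inst : ∀ {k} → Fm → Vec Term k → Fm
inst A ts = substF (xsub 0 ts) A

xbar : (k : ℕ) → Vec Term k
xbar k = tabulate (λ (i : Fin k) → var (xs (toℕ i)))

psub : PSym → Fm → Fm → Fm
psub p G top = top
psub p G bot = bot
psub p G (atom q ts) = if ⌊ q ≟P p ⌋ then inst G ts else atom q ts
psub p G (equ t u) = equ t u
psub p G (neg φ) = neg (psub p G φ)
psub p G (bin o φ ψ) = bin o (psub p G φ) (psub p G ψ)
psub p G (qi Q y φ) = qi Q y (psub p G φ)
psub p G (qp Q q φ) = if ⌊ q ≟P p ⌋ then qp Q q φ else qp Q q (psub p G φ)

IRen : Set
IRen = List (Ind × Ind)

PRen : Set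
PRen = List (PSym × ℕ)

renI : IRen → Ind → Ind
renI [] y = y
renI ((z , z') ∷ ρ) y = if ⌊ z ≟I y ⌋ then z' else renI ρ y

renNm : PRen → PSym → ℕ
renNm [] q = nm q
renNm ((r , n) ∷ ρ) q = if ⌊ r ≟P q ⌋ then n else renNm ρ q

renP : PRen → PSym → PSym
renP ρ q = psym (ar q) (renNm ρ q)

renT : IRen → Term → Term
renTs : ∀ {n} → IRen → Vec Term n → Vec Term n
renT ρ (var y) = var (renI ρ y)
renT ρ (app f ts) = app f (renTs ρ ts)
renTs ρ [] = []
renTs ρ (t ∷ ts) = renT ρ t ∷ renTs ρ ts

-- the counter c is a name above every name already used
ren : IRen → PRen → Fm → ℕ → Fm × ℕ
ren ρ π top c = top , c
ren ρ π bot c = bot , c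
ren ρ π (atom q ts) c = atom (renP π q) (renTs ρ ts) , c
ren ρ π (equ t u) c = equ (renT ρ t) (renT ρ u) , c
ren ρ π (neg φ) c with ren ρ π φ c
... | φ' , c' = neg φ' , c'
ren ρ π (bin o φ ψ) c with ren ρ π φ c
... | φ' , c₁ with ren ρ π ψ c₁
... | ψ' , c₂ = bin o φ' ψ' , c₂
ren ρ π (qi Q y φ) c with ren ((y , ys c) ∷ ρ) π φ (suc c)
... | φ' , c' = qi Q (ys c) φ' , c'
ren ρ π (qp Q q φ) c with ren ρ ((q , c) ∷ π) φ (suc c)
... | φ' , c' = qp Q (psym (ar q) c) φ' , c'

cleanVariant : Fm → Fm
cleanVariant G = proj₁ (ren [] [] G (maxY G ⊔ maxP G))

-- Semantics (classical, via the Gödel–Gentzen negative translation: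
-- every ⟦ F ⟧ is ¬¬-stable)

record Interp (D : Set) : Set₁ where
  field
    ind : Ind → D
    fun : (f : FSym) → Vec D (FSym.far f) → D
    rel : (q : PSym) → Vec D (ar q) → Set

open Interp public

updI : ∀ {D} → Interp D → Ind → D → Interp D
updI I y d = record I { ind = λ z → if ⌊ z ≟I y ⌋ then d else ind I z }

updRel : ∀ {D} → Interp D → (q : PSym) → (Vec D (ar q) → Set) → (r : PSym) → Vec D (ar r) → Set
updRel I q R r with r ≟P q
... | yes refl = R
... | no _ = rel I r

updP : ∀ {D} → Interp D → (q : PSym) → (Vec D (ar q) → Set) → Interp D
updP I q R = record I { rel = updRel I q R }

evalT : ∀ {D} → Interp D → Term → D
evalTs : ∀ {D n} → Interp D → Vec Term n → Vec D n
evalT I (var y) = ind I y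
evalT I (app f ts) = fun I f (evalTs I ts)
evalTs I [] = []
evalTs I (t ∷ ts) = evalT I t ∷ evalTs I ts

⟦_⟧ : {D : Set} → Fm → Interp D → Set₁
⟦ top ⟧ I = Lift _ ⊤
⟦ bot ⟧ I = Lift _ ⊥
⟦ atom q ts ⟧ I = Lift _ (¬ ¬ rel I q (evalTs I ts))
⟦ equ t u ⟧ I = Lift _ (¬ ¬ (evalT I t ≡ evalT I u))
⟦ neg φ ⟧ I = ¬ ⟦ φ ⟧ I
⟦ bin andOp φ ψ ⟧ I = ⟦ φ ⟧ I × ⟦ ψ ⟧ I
⟦ bin orOp φ ψ ⟧ I = ¬ ¬ (⟦ φ ⟧ I ⊎ ⟦ ψ ⟧ I)
⟦ bin impOp φ ψ ⟧ I = ⟦ φ ⟧ I → ⟦ ψ ⟧ I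
⟦_⟧ {D} (qi forallQ y φ) I = (d : D) → ⟦ φ ⟧ (updI I y d)
⟦_⟧ {D} (qi existsQ y φ) I = ¬ ¬ (Σ D λ d → ⟦ φ ⟧ (updI I y d))
⟦_⟧ {D} (qp forallQ q φ) I = (R : Vec D (ar q) → Set) → ⟦ φ ⟧ (updP I q R)
⟦_⟧ {D} (qp existsQ q φ) I = ¬ ¬ (Σ (Vec D (ar q) → Set) λ R → ⟦ φ ⟧ (updP I q R))

Valid : Fm → Set₁
Valid F = ∀ (D : Set) (I : Interp D) → ⟦ F ⟧ I

_≃F_ : Fm → Fm → Set₁
F ≃F G = ∀ (D : Set) (I : Interp D) → (⟦ F ⟧ I → ⟦ G ⟧ I) × (⟦ G ⟧ I → ⟦ F ⟧ I)

Solution : Fm → PSym → Fm → Set₁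
Solution F p G = SUBST G p F × Valid (psub p G F)

HasSolution : Fm → PSym → Set₁
HasSolution F p = Σ Fm (Solution F p)

ReprProblem : Fm → PSym → PSym → Set
ReprProblem F p t = (ar t ≡ ar p) × ¬ FreeIn (sp t) F × (t ≢ p)

ParametricSolution : Fm → PSym → PSym → Fm → Set₁
ParametricSolution F p t G =
  Clean G × SUBST G p F ×
  (∀ H → SUBST H t G → SUBST H p F →
     Σ Fm (λ T → SUBST T t G × SUBST (psub t T G) p F × (H ≃F psub t T G)) →
     Valid (psub p H F))

ReproductiveSolution : Fm → PSym → PSym → Fm → Set₁
ReproductiveSolution F p t G =
  ParametricSolution F p t G ×
  (∀ H → SUBST H t G → SUBST H p F → Valid (psub p H F) → H ≃F psub t H G)

allVec : ∀ {n} → Vec Ind n → Fm → Fm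
allVec [] φ = φ
allVec (y ∷ ys') φ = qi forallQ y (allVec ys' φ)

Fsandwich : (p : PSym) → Vec Ind (ar p) → Fm → Fm → Fm
Fsandwich p ȳ A B =
  bin andOp
    (allVec ȳ (bin impOp (inst A (vmap var ȳ)) (atom p (vmap var ȳ))))
    (allVec ȳ (bin impOp (atom p (vmap var ȳ)) (inst B (vmap var ȳ))))

NotX : Ind → Set
NotX y = ∀ j → y ≢ xs j

-- Because ȳ is bound in F and no free symbol of a candidate C is captured
-- there, F[C] is valid iff A ⊨ C and C ⊨ B.  A solution exists, so A ⊨ B,
-- and then every instance A ∨ (B ∧ T) lies between A and B, i.e. is a
-- solution; conversely a solution H with A ⊨ H ⊨ B is equivalent to
-- A ∨ (B ∧ H), its own instance.  What remains is syntax: the clean variant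
-- only renames bound symbols, so it has the same free symbols and meaning.
module Submission where

open import Defs
open import Data.Fin using (Fin)
open import Data.Vec using (Vec; lookup)
open import Relation.Binary.PropositionalEquality using (_≡_)

open import Data.Fin using (toℕ; fromℕ<) renaming (zero to fz; suc to fs)
open import Data.Fin.Properties using (toℕ-injective; toℕ-fromℕ<; toℕ<n)
open import Data.Vec using ([]; _∷_; tabulate) renaming (map to vmap)
open import Data.Vec.Properties using (lookup∘tabulate; lookup-map)
open import Relation.Binary.PropositionalEquality using (_≢_; refl; sym; trans; cong; cong₂; subst; module ≡-Reasoning)
open import Data.Nat using (ℕ; suc; _≤_; _<_; _⊔_; _+_; s≤s)
open import Data.Nat.Properties using (≤-refl; ≤-trans; ≤-reflexive; m≤m⊔n; m≤n⊔m; ⊔-mono-≤; n≤1+n; 1+n≰n; _<?_; +-suc; +-identityʳ; m≤m+n)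
open import Data.Bool using (true; false)
open import Data.Product using (Σ; _×_; _,_; proj₁; proj₂)
open import Data.Sum using (_⊎_; inj₁; inj₂; [_,_])
open import Data.Unit using (tt)
open import Data.Empty using (⊥-elim)
open import Data.List using ([]; _∷_)
open import Level using (Lift; lift; lower)
open import Function.Bundles using (_⇔_; mk⇔; Equivalence)
open import Function.Construct.Identity using (⇔-id)
open import Function.Construct.Symmetry using (⇔-sym)
open import Function.Construct.Composition using (_⇔-∘_)
open import Data.Product.Function.NonDependent.Propositional using (_×-⇔_)
open import Data.Sum.Function.Propositional using (_⊎-⇔_)
open import Function.Related.TypeIsomorphisms using (→-cong-⇔; ¬-cong-⇔)
open import Relation.Nullary using (¬_; yes; no)
open import Relation.Nullary.Decidable using (⌊_⌋)
open import Relation.Nullary.Negation.Core using (Stable)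

open Equivalence using (to; from)

≟I-refl : ∀ y → ⌊ y ≟I y ⌋ ≡ true
≟I-refl y with y ≟I y
... | yes _ = refl
... | no y≢y = ⊥-elim (y≢y refl)

≟I-≢ : ∀ {y z} → y ≢ z → ⌊ y ≟I z ⌋ ≡ false
≟I-≢ {y} {z} y≢z with y ≟I z
... | yes y≡z = ⊥-elim (y≢z y≡z)
... | no _ = refl

≟P-refl : ∀ q → ⌊ q ≟P q ⌋ ≡ true
≟P-refl q with q ≟P q
... | yes _ = refl
... | no q≢q = ⊥-elim (q≢q refl)

≟P-≢ : ∀ {q r} → q ≢ r → ⌊ q ≟P r ⌋ ≡ false
≟P-≢ {q} {r} q≢r with q ≟P r
... | yes q≡r = ⊥-elim (q≢r q≡r)
... | no _ = refl

si-injective : ∀ {a b} → si a ≡ si b → a ≡ b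
si-injective refl = refl

sp-injective : ∀ {a b} → sp a ≡ sp b → a ≡ b
sp-injective refl = refl

xs-injective : ∀ {a b} → xs a ≡ xs b → a ≡ b
xs-injective refl = refl

occTB-yIdx≤ : ∀ w t → occTB w t ≡ true → yIdx w ≤ maxYT t
occTsB-yIdx≤ : ∀ {n} w (ts : Vec Term n) → occTsB w ts ≡ true → yIdx w ≤ maxYTs ts
occTB-yIdx≤ w (var z) e with w ≟I z
occTB-yIdx≤ w (var z) e | yes refl = ≤-refl
occTB-yIdx≤ w (var z) () | no _
occTB-yIdx≤ w (app f ts) e = occTsB-yIdx≤ w ts e
occTsB-yIdx≤ w (t ∷ ts) e with occTB w t in e₁
... | true = ≤-trans (occTB-yIdx≤ w t e₁) (m≤m⊔n _ _)
... | false = ≤-trans (occTsB-yIdx≤ w ts e) (m≤n⊔m _ _)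

occTB-fresh : ∀ w t → maxYT t < yIdx w → occTB w t ≡ false
occTB-fresh w t lt with occTB w t in e
... | true = ⊥-elim (1+n≰n (≤-trans lt (occTB-yIdx≤ w t e)))
... | false = refl

OccT-yIdx≤ : ∀ z t → OccT (si z) t → yIdx z ≤ maxYT t
OccTs-yIdx≤ : ∀ {n} z (ts : Vec Term n) → OccTs (si z) ts → yIdx z ≤ maxYTs ts
OccT-yIdx≤ z (var y) (o-var refl) = ≤-refl
OccT-yIdx≤ z (app f ts) (o-arg o) = OccTs-yIdx≤ z ts o
OccTs-yIdx≤ z (t ∷ ts) (o-hd o) = ≤-trans (OccT-yIdx≤ z t o) (m≤m⊔n _ _)
OccTs-yIdx≤ z (t ∷ ts) (o-tl o) = ≤-trans (OccTs-yIdx≤ z ts o) (m≤n⊔m _ _)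

FreeIn-yIdx≤ : ∀ z φ → FreeIn (si z) φ → yIdx z ≤ maxY φ
FreeIn-yIdx≤ z (atom q ts) (f-arg o) = OccTs-yIdx≤ z ts o
FreeIn-yIdx≤ z (equ t u) (f-eqˡ o) = ≤-trans (OccT-yIdx≤ z t o) (m≤m⊔n _ _)
FreeIn-yIdx≤ z (equ t u) (f-eqʳ o) = ≤-trans (OccT-yIdx≤ z u o) (m≤n⊔m _ _)
FreeIn-yIdx≤ z (neg φ) (f-neg fr) = FreeIn-yIdx≤ z φ fr
FreeIn-yIdx≤ z (bin o φ ψ) (f-binˡ fr) = ≤-trans (FreeIn-yIdx≤ z φ fr) (m≤m⊔n _ _)
FreeIn-yIdx≤ z (bin o φ ψ) (f-binʳ fr) = ≤-trans (FreeIn-yIdx≤ z ψ fr) (m≤n⊔m _ _)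
FreeIn-yIdx≤ z (qi Q y φ) (f-qi _ fr) = ≤-trans (FreeIn-yIdx≤ z φ fr) (m≤n⊔m _ _)
FreeIn-yIdx≤ z (qp Q q φ) (f-qp _ fr) = FreeIn-yIdx≤ z φ fr

¬OccT-sp : ∀ q t → ¬ OccT (sp q) t
¬OccTs-sp : ∀ {n} q (ts : Vec Term n) → ¬ OccTs (sp q) ts
¬OccT-sp q (app f ts) (o-arg o) = ¬OccTs-sp q ts o
¬OccTs-sp q (t ∷ ts) (o-hd o) = ¬OccT-sp q t o
¬OccTs-sp q (t ∷ ts) (o-tl o) = ¬OccTs-sp q ts o

FreeIn-nm<maxP : ∀ q φ → FreeIn (sp q) φ → nm q < maxP φ
FreeIn-nm<maxP q (atom r ts) (f-pred refl) = ≤-refl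
FreeIn-nm<maxP q (atom r ts) (f-arg o) = ⊥-elim (¬OccTs-sp q ts o)
FreeIn-nm<maxP q (equ t u) (f-eqˡ o) = ⊥-elim (¬OccT-sp q t o)
FreeIn-nm<maxP q (equ t u) (f-eqʳ o) = ⊥-elim (¬OccT-sp q u o)
FreeIn-nm<maxP q (neg φ) (f-neg fr) = FreeIn-nm<maxP q φ fr
FreeIn-nm<maxP q (bin o φ ψ) (f-binˡ fr) = ≤-trans (FreeIn-nm<maxP q φ fr) (m≤m⊔n _ _)
FreeIn-nm<maxP q (bin o φ ψ) (f-binʳ fr) = ≤-trans (FreeIn-nm<maxP q ψ fr) (m≤n⊔m _ _)
FreeIn-nm<maxP q (qi Q y φ) (f-qi _ fr) = FreeIn-nm<maxP q φ fr
FreeIn-nm<maxP q (qp Q r φ) (f-qp _ fr) = ≤-trans (FreeIn-nm<maxP q φ fr) (m≤n⊔m _ _)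

fresh : Fm → ℕ
fresh φ = maxY φ ⊔ maxP φ

fresh-binˡ : ∀ o φ ψ → fresh φ ≤ fresh (bin o φ ψ)
fresh-binˡ o φ ψ = ⊔-mono-≤ (m≤m⊔n (maxY φ) (maxY ψ)) (m≤m⊔n (maxP φ) (maxP ψ))

fresh-binʳ : ∀ o φ ψ → fresh ψ ≤ fresh (bin o φ ψ)
fresh-binʳ o φ ψ = ⊔-mono-≤ (m≤n⊔m (maxY φ) (maxY ψ)) (m≤n⊔m (maxP φ) (maxP ψ))

¬¬-cong-⇔ : ∀ {a b} {A : Set a} {B : Set b} → A ⇔ B → (¬ ¬ A) ⇔ (¬ ¬ B)
¬¬-cong-⇔ e = ¬-cong-⇔ (¬-cong-⇔ e)

Lift-¬¬-cong-⇔ : ∀ {ℓ} {R S : Set} → R ⇔ S → Lift ℓ (¬ ¬ R) ⇔ Lift ℓ (¬ ¬ S)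
Lift-¬¬-cong-⇔ e = mk⇔ (λ x → lift (to (¬¬-cong-⇔ e) (lower x))) (λ x → lift (from (¬¬-cong-⇔ e) (lower x)))

Π-cong-⇔ : ∀ {a b c} {X : Set a} {P : X → Set b} {Q : X → Set c} →
           (∀ x → P x ⇔ Q x) → ((x : X) → P x) ⇔ ((x : X) → Q x)
Π-cong-⇔ e = mk⇔ (λ f x → to (e x) (f x)) (λ g x → from (e x) (g x))

Σ-cong-⇔ : ∀ {a b c} {X : Set a} {P : X → Set b} {Q : X → Set c} →
           (∀ x → P x ⇔ Q x) → Σ X P ⇔ Σ X Q
Σ-cong-⇔ e = mk⇔ (λ { (x , px) → x , to (e x) px }) (λ { (x , qx) → x , from (e x) qx })

⟦bin⟧-cong : ∀ {D} o {φ φ' ψ ψ'} {I J : Interp D} → ⟦ φ' ⟧ I ⇔ ⟦ φ ⟧ J → ⟦ ψ' ⟧ I ⇔ ⟦ ψ ⟧ J →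
             ⟦ bin o φ' ψ' ⟧ I ⇔ ⟦ bin o φ ψ ⟧ J
⟦bin⟧-cong andOp e f = e ×-⇔ f
⟦bin⟧-cong orOp e f = ¬¬-cong-⇔ (e ⊎-⇔ f)
⟦bin⟧-cong impOp e f = →-cong-⇔ e f

⟦qi⟧-cong : ∀ {D} Q {y y' φ φ'} {I J : Interp D} →
            (∀ d → ⟦ φ' ⟧ (updI I y' d) ⇔ ⟦ φ ⟧ (updI J y d)) → ⟦ qi Q y' φ' ⟧ I ⇔ ⟦ qi Q y φ ⟧ J
⟦qi⟧-cong forallQ e = Π-cong-⇔ e
⟦qi⟧-cong existsQ e = ¬¬-cong-⇔ (Σ-cong-⇔ e)

⟦qp⟧-cong : ∀ {D} Q {q n φ φ'} {I J : Interp D} →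
            (∀ R → ⟦ φ' ⟧ (updP I (psym (ar q) n) R) ⇔ ⟦ φ ⟧ (updP J q R)) →
            ⟦ qp Q (psym (ar q) n) φ' ⟧ I ⇔ ⟦ qp Q q φ ⟧ J
⟦qp⟧-cong forallQ e = Π-cong-⇔ e
⟦qp⟧-cong existsQ e = ¬¬-cong-⇔ (Σ-cong-⇔ e)

⟦⟧-stable : ∀ {D} φ (I : Interp D) → Stable (⟦ φ ⟧ I)
⟦⟧-stable top I _ = lift tt
⟦⟧-stable bot I ¬¬φ = ⊥-elim (¬¬φ lower)
⟦⟧-stable (atom q ts) I ¬¬φ = lift (λ ¬r → ¬¬φ (λ x → lower x ¬r))
⟦⟧-stable (equ t u) I ¬¬φ = lift (λ ¬r → ¬¬φ (λ x → lower x ¬r))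
⟦⟧-stable (neg φ) I ¬¬φ = λ x → ¬¬φ (λ ¬x → ¬x x)
⟦⟧-stable (bin andOp φ ψ) I ¬¬φ =
  ⟦⟧-stable φ I (λ k → ¬¬φ (λ x → k (proj₁ x))) , ⟦⟧-stable ψ I (λ k → ¬¬φ (λ x → k (proj₂ x)))
⟦⟧-stable (bin orOp φ ψ) I ¬¬φ = λ k → ¬¬φ (λ x → x k)
⟦⟧-stable (bin impOp φ ψ) I ¬¬φ = λ a → ⟦⟧-stable ψ I (λ k → ¬¬φ (λ f → k (f a)))
⟦⟧-stable (qi forallQ y φ) I ¬¬φ = λ d → ⟦⟧-stable φ (updI I y d) (λ k → ¬¬φ (λ f → k (f d)))
⟦⟧-stable (qi existsQ y φ) I ¬¬φ = λ k → ¬¬φ (λ x → x k)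
⟦⟧-stable (qp forallQ q φ) I ¬¬φ = λ R → ⟦⟧-stable φ (updP I q R) (λ k → ¬¬φ (λ f → k (f R)))
⟦⟧-stable (qp existsQ q φ) I ¬¬φ = λ k → ¬¬φ (λ x → x k)

FunsAgree : ∀ {D} → Interp D → Interp D → Set
FunsAgree {D} I J = ∀ f (v : Vec D (FSym.far f)) → fun J f v ≡ fun I f v

RelsAgree : ∀ {D} → Interp D → Interp D → Set
RelsAgree {D} I J = ∀ q (v : Vec D (ar q)) → rel J q v ⇔ rel I q v

updI-≡ : ∀ {D} (I : Interp D) y d → ind (updI I y d) y ≡ d
updI-≡ I y d rewrite ≟I-refl y = refl

updI-≢ : ∀ {D} (I : Interp D) {y z} d → z ≢ y → ind (updI I y d) z ≡ ind I z
updI-≢ I d z≢y rewrite ≟I-≢ z≢y = refl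

updRel-≡ : ∀ {D} (I : Interp D) q R v → updRel I q R q v ≡ R v
updRel-≡ I q R v with q ≟P q
... | yes refl = refl
... | no q≢q = ⊥-elim (q≢q refl)

updRel-≢ : ∀ {D} (I : Interp D) q R r v → r ≢ q → updRel I q R r v ≡ rel I r v
updRel-≢ I q R r v r≢q with r ≟P q
... | yes r≡q = ⊥-elim (r≢q r≡q)
... | no _ = refl

RelsAgree-updP : ∀ {D} (I J : Interp D) q R → RelsAgree I J → RelsAgree (updP I q R) (updP J q R)
RelsAgree-updP I J q R agree r v with r ≟P q
... | yes refl = ⇔-id _
... | no _ = agree r v

evalT-updP : ∀ {D} (I : Interp D) q R t → evalT (updP I q R) t ≡ evalT I t
evalTs-updP : ∀ {D n} (I : Interp D) q R (ts : Vec Term n) → evalTs (updP I q R) ts ≡ evalTs I ts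
evalT-updP I q R (var y) = refl
evalT-updP I q R (app f ts) = cong (fun I f) (evalTs-updP I q R ts)
evalTs-updP I q R [] = refl
evalTs-updP I q R (t ∷ ts) = cong₂ _∷_ (evalT-updP I q R t) (evalTs-updP I q R ts)

evalT-updI-fresh : ∀ {D} (I : Interp D) w d t → occTB w t ≡ false → evalT (updI I w d) t ≡ evalT I t
evalTs-updI-fresh : ∀ {D n} (I : Interp D) w d (ts : Vec Term n) → occTsB w ts ≡ false →
                    evalTs (updI I w d) ts ≡ evalTs I ts
evalT-updI-fresh I w d (var z) e with w ≟I z
evalT-updI-fresh I w d (var z) () | yes _
... | no w≢z = updI-≢ I d (λ e → w≢z (sym e))
evalT-updI-fresh I w d (app f ts) e = cong (fun I f) (evalTs-updI-fresh I w d ts e)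
evalTs-updI-fresh I w d [] e = refl
evalTs-updI-fresh I w d (t ∷ ts) e with occTB w t in e₁
evalTs-updI-fresh I w d (t ∷ ts) () | true
... | false = cong₂ _∷_ (evalT-updI-fresh I w d t e₁) (evalTs-updI-fresh I w d ts e)

lookupS-∷-≡ : ∀ y t σ → lookupS ((y , t) ∷ σ) y ≡ t
lookupS-∷-≡ y t σ rewrite ≟I-refl y = refl

lookupS-∷-≢ : ∀ {y z} t σ → y ≢ z → lookupS ((y , t) ∷ σ) z ≡ lookupS σ z
lookupS-∷-≢ t σ y≢z rewrite ≟I-≢ y≢z = refl

lookupS-removeS-≡ : ∀ y σ → lookupS (removeS y σ) y ≡ var y
lookupS-removeS-≡ y [] = refl
lookupS-removeS-≡ y ((u , t) ∷ σ) with u ≟I y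
... | yes _ = lookupS-removeS-≡ y σ
... | no u≢y rewrite ≟I-≢ u≢y = lookupS-removeS-≡ y σ

lookupS-removeS-≢ : ∀ {y z} σ → y ≢ z → lookupS (removeS y σ) z ≡ lookupS σ z
lookupS-removeS-≢ [] _ = refl
lookupS-removeS-≢ {y} {z} ((u , t) ∷ σ) y≢z with u ≟I y
... | yes refl rewrite ≟I-≢ y≢z = lookupS-removeS-≢ σ y≢z
... | no _ with u ≟I z
...   | yes _ = refl
...   | no _ = lookupS-removeS-≢ σ y≢z

occTB-lookupS-fresh : ∀ σ z w → maxYS σ < yIdx w → w ≢ z → occTB w (lookupS σ z) ≡ false
occTB-lookupS-fresh [] z w lt w≢z = ≟I-≢ w≢z
occTB-lookupS-fresh ((u , t) ∷ σ) z w lt w≢z with u ≟I z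
... | yes _ = occTB-fresh w t (≤-trans (s≤s (≤-trans (m≤n⊔m (yIdx u) (maxYT t)) (m≤m⊔n _ (maxYS σ)))) lt)
... | no _ = occTB-lookupS-fresh σ z w (≤-trans (s≤s (m≤n⊔m _ _)) lt) w≢z

occTB-lookupS-∉ : ∀ σ z w → occS w σ ≡ false → w ≢ z → occTB w (lookupS σ z) ≡ false
occTB-lookupS-∉ [] z w e w≢z = ≟I-≢ w≢z
occTB-lookupS-∉ ((u , t) ∷ σ) z w e w≢z with occTB w t in e₁
occTB-lookupS-∉ ((u , t) ∷ σ) z w () w≢z | true
... | false with u ≟I z
... | yes _ = e₁
... | no _ = occTB-lookupS-∉ σ z w e w≢z

evalT-substT : ∀ {D} (I J : Interp D) σ → FunsAgree I J → ∀ t →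
               (∀ z → OccT (si z) t → ind J z ≡ evalT I (lookupS σ z)) → evalT J t ≡ evalT I (substT σ t)
evalTs-substTs : ∀ {D n} (I J : Interp D) σ → FunsAgree I J → (ts : Vec Term n) →
                 (∀ z → OccTs (si z) ts → ind J z ≡ evalT I (lookupS σ z)) → evalTs J ts ≡ evalTs I (substTs σ ts)
evalT-substT I J σ fa (var y) h = h y (o-var refl)
evalT-substT I J σ fa (app f ts) h =
  trans (fa f (evalTs J ts)) (cong (fun I f) (evalTs-substTs I J σ fa ts (λ z o → h z (o-arg o))))
evalTs-substTs I J σ fa [] h = refl
evalTs-substTs I J σ fa (t ∷ ts) h =
  cong₂ _∷_ (evalT-substT I J σ fa t (λ z o → h z (o-hd o))) (evalTs-substTs I J σ fa ts (λ z o → h z (o-tl o)))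

SubstAgrees : ∀ {D} → Fm → Sub → Interp D → Interp D → Set
SubstAgrees φ σ I J = ∀ z → FreeIn (si z) φ → ind J z ≡ evalT I (lookupS σ z)

substF-correct : ∀ {D} φ σ (I J : Interp D) → FunsAgree I J → RelsAgree I J →
                 SubstAgrees φ σ I J → ⟦ substF σ φ ⟧ I ⇔ ⟦ φ ⟧ J
substF-correct top σ I J fa ra ia = ⇔-id _
substF-correct bot σ I J fa ra ia = ⇔-id _
substF-correct (atom q ts) σ I J fa ra ia
  rewrite evalTs-substTs I J σ fa ts (λ z o → ia z (f-arg o)) = Lift-¬¬-cong-⇔ (⇔-sym (ra q _))
substF-correct (equ t u) σ I J fa ra ia
  rewrite evalT-substT I J σ fa t (λ z o → ia z (f-eqˡ o))
        | evalT-substT I J σ fa u (λ z o → ia z (f-eqʳ o)) = ⇔-id _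
substF-correct (neg φ) σ I J fa ra ia = ¬-cong-⇔ (substF-correct φ σ I J fa ra (λ z fr → ia z (f-neg fr)))
substF-correct (bin o φ ψ) σ I J fa ra ia =
  ⟦bin⟧-cong o (substF-correct φ σ I J fa ra (λ z fr → ia z (f-binˡ fr)))
               (substF-correct ψ σ I J fa ra (λ z fr → ia z (f-binʳ fr)))
substF-correct (qi Q y φ) σ I J fa ra ia with occS y (removeS y σ) in captured
... | true = ⟦qi⟧-cong Q (λ d → substF-correct φ ((y , var y') ∷ σ') (updI I y' d) (updI J y d) fa ra (agree d))
  where
  σ' = removeS y σ
  y' = ys (maxYS σ' ⊔ maxY φ)
  agree : ∀ d → SubstAgrees φ ((y , var y') ∷ σ') (updI I y' d) (updI J y d)
  agree d z fr with z ≟I y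
  ... | yes refl = sym (trans (cong (evalT (updI I y' d)) (lookupS-∷-≡ y (var y') σ')) (updI-≡ I y' d))
  ... | no z≢y = begin
    ind J z                                              ≡⟨ ia z (f-qi (λ e → z≢y (si-injective e)) fr) ⟩
    evalT I (lookupS σ z)                                ≡⟨ cong (evalT I) (sym (lookupS-removeS-≢ σ y≢z)) ⟩
    evalT I (lookupS σ' z)                               ≡⟨ sym (evalT-updI-fresh I y' d (lookupS σ' z) (occTB-lookupS-fresh σ' z y' (s≤s (m≤m⊔n _ _)) y'≢z)) ⟩
    evalT (updI I y' d) (lookupS σ' z)                   ≡⟨ cong (evalT (updI I y' d)) (sym (lookupS-∷-≢ (var y') σ' y≢z)) ⟩
    evalT (updI I y' d) (lookupS ((y , var y') ∷ σ') z)  ∎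
    where
    open ≡-Reasoning
    y≢z : y ≢ z
    y≢z e = z≢y (sym e)
    y'≢z : y' ≢ z
    y'≢z e = 1+n≰n (≤-trans (s≤s (m≤n⊔m (maxYS σ') (maxY φ)))
                   (≤-trans (≤-reflexive (cong yIdx e)) (FreeIn-yIdx≤ z φ fr)))
... | false = ⟦qi⟧-cong Q (λ d → substF-correct φ σ' (updI I y d) (updI J y d) fa ra (agree d))
  where
  σ' = removeS y σ
  agree : ∀ d → SubstAgrees φ σ' (updI I y d) (updI J y d)
  agree d z fr with z ≟I y
  ... | yes refl = sym (trans (cong (evalT (updI I y d)) (lookupS-removeS-≡ y σ)) (updI-≡ I y d))
  ... | no z≢y = begin
    ind J z                           ≡⟨ ia z (f-qi (λ e → z≢y (si-injective e)) fr) ⟩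
    evalT I (lookupS σ z)            ≡⟨ cong (evalT I) (sym (lookupS-removeS-≢ σ y≢z)) ⟩
    evalT I (lookupS σ' z)           ≡⟨ sym (evalT-updI-fresh I y d (lookupS σ' z) (occTB-lookupS-∉ σ' z y captured y≢z)) ⟩
    evalT (updI I y d) (lookupS σ' z) ∎
    where
    open ≡-Reasoning
    y≢z : y ≢ z
    y≢z e = z≢y (sym e)
substF-correct (qp Q q φ) σ I J fa ra ia =
  ⟦qp⟧-cong Q (λ R → substF-correct φ σ (updP I q R) (updP J q R) fa (RelsAgree-updP I J q R ra)
    (λ z fr → trans (ia z (f-qp (λ ()) fr)) (sym (evalT-updP I q R (lookupS σ z)))))

substF-[] : ∀ φ → substF [] φ ≡ φ
substTs-[] : ∀ {n} (ts : Vec Term n) → substTs [] ts ≡ ts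
substT-[] : ∀ t → substT [] t ≡ t
substT-[] (var y) = refl
substT-[] (app f ts) = cong (app f) (substTs-[] ts)
substTs-[] [] = refl
substTs-[] (t ∷ ts) = cong₂ _∷_ (substT-[] t) (substTs-[] ts)
substF-[] top = refl
substF-[] bot = refl
substF-[] (atom q ts) = cong (atom q) (substTs-[] ts)
substF-[] (equ t u) = cong₂ equ (substT-[] t) (substT-[] u)
substF-[] (neg φ) = cong neg (substF-[] φ)
substF-[] (bin o φ ψ) = cong₂ (bin o) (substF-[] φ) (substF-[] ψ)
substF-[] (qi Q y φ) = cong (qi Q y) (substF-[] φ)
substF-[] (qp Q q φ) = cong (qp Q q) (substF-[] φ)

⟦⟧-coincidence : ∀ {D} φ (I J : Interp D) → FunsAgree I J → RelsAgree I J →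
                 (∀ z → FreeIn (si z) φ → ind J z ≡ ind I z) → ⟦ φ ⟧ I ⇔ ⟦ φ ⟧ J
⟦⟧-coincidence φ I J fa ra ia = subst (λ ψ → ⟦ ψ ⟧ I ⇔ ⟦ φ ⟧ J) (substF-[] φ) (substF-correct φ [] I J fa ra ia)

FreeIn-sp-substF⁻ : ∀ q φ σ → FreeIn (sp q) (substF σ φ) → FreeIn (sp q) φ
FreeIn-sp-substF⁻ q (atom r ts) σ (f-pred e) = f-pred e
FreeIn-sp-substF⁻ q (atom r ts) σ (f-arg o) = ⊥-elim (¬OccTs-sp q _ o)
FreeIn-sp-substF⁻ q (equ t u) σ (f-eqˡ o) = ⊥-elim (¬OccT-sp q _ o)
FreeIn-sp-substF⁻ q (equ t u) σ (f-eqʳ o) = ⊥-elim (¬OccT-sp q _ o)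
FreeIn-sp-substF⁻ q (neg φ) σ (f-neg f) = f-neg (FreeIn-sp-substF⁻ q φ σ f)
FreeIn-sp-substF⁻ q (bin o φ ψ) σ (f-binˡ f) = f-binˡ (FreeIn-sp-substF⁻ q φ σ f)
FreeIn-sp-substF⁻ q (bin o φ ψ) σ (f-binʳ f) = f-binʳ (FreeIn-sp-substF⁻ q ψ σ f)
FreeIn-sp-substF⁻ q (qi Q y φ) σ f with occS y (removeS y σ)
FreeIn-sp-substF⁻ q (qi Q y φ) σ (f-qi _ f) | true = f-qi (λ ()) (FreeIn-sp-substF⁻ q φ _ f)
FreeIn-sp-substF⁻ q (qi Q y φ) σ (f-qi _ f) | false = f-qi (λ ()) (FreeIn-sp-substF⁻ q φ _ f)
FreeIn-sp-substF⁻ q (qp Q r φ) σ (f-qp r≢q f) = f-qp r≢q (FreeIn-sp-substF⁻ q φ σ f)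

FreeIn-sp-substF⁺ : ∀ q φ σ → FreeIn (sp q) φ → FreeIn (sp q) (substF σ φ)
FreeIn-sp-substF⁺ q (atom r ts) σ (f-pred e) = f-pred e
FreeIn-sp-substF⁺ q (atom r ts) σ (f-arg o) = ⊥-elim (¬OccTs-sp q _ o)
FreeIn-sp-substF⁺ q (equ t u) σ (f-eqˡ o) = ⊥-elim (¬OccT-sp q _ o)
FreeIn-sp-substF⁺ q (equ t u) σ (f-eqʳ o) = ⊥-elim (¬OccT-sp q _ o)
FreeIn-sp-substF⁺ q (neg φ) σ (f-neg f) = f-neg (FreeIn-sp-substF⁺ q φ σ f)
FreeIn-sp-substF⁺ q (bin o φ ψ) σ (f-binˡ f) = f-binˡ (FreeIn-sp-substF⁺ q φ σ f)
FreeIn-sp-substF⁺ q (bin o φ ψ) σ (f-binʳ f) = f-binʳ (FreeIn-sp-substF⁺ q ψ σ f)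
FreeIn-sp-substF⁺ q (qi Q y φ) σ (f-qi _ f) with occS y (removeS y σ)
... | true = f-qi (λ ()) (FreeIn-sp-substF⁺ q φ _ f)
... | false = f-qi (λ ()) (FreeIn-sp-substF⁺ q φ _ f)
FreeIn-sp-substF⁺ q (qp Q r φ) σ (f-qp r≢q f) = f-qp r≢q (FreeIn-sp-substF⁺ q φ σ f)

renI-≡ : ∀ y w ρ → renI ((y , w) ∷ ρ) y ≡ w
renI-≡ y w ρ rewrite ≟I-refl y = refl

renI-≢ : ∀ {y z} w ρ → y ≢ z → renI ((y , w) ∷ ρ) z ≡ renI ρ z
renI-≢ w ρ y≢z rewrite ≟I-≢ y≢z = refl

renNm-≡ : ∀ q c π → renNm ((q , c) ∷ π) q ≡ c
renNm-≡ q c π rewrite ≟P-refl q = refl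

renNm-≢ : ∀ {q r} c π → q ≢ r → renNm ((q , c) ∷ π) r ≡ renNm π r
renNm-≢ c π q≢r rewrite ≟P-≢ q≢r = refl

renTs-[] : ∀ {n} (ts : Vec Term n) → renTs [] ts ≡ ts
renT-[] : ∀ t → renT [] t ≡ t
renT-[] (var y) = refl
renT-[] (app f ts) = cong (app f) (renTs-[] ts)
renTs-[] [] = refl
renTs-[] (t ∷ ts) = cong₂ _∷_ (renT-[] t) (renTs-[] ts)

ren-counter-≤ : ∀ φ ρ π c → c ≤ proj₂ (ren ρ π φ c)
ren-counter-≤ top ρ π c = ≤-refl
ren-counter-≤ bot ρ π c = ≤-refl
ren-counter-≤ (atom q ts) ρ π c = ≤-refl
ren-counter-≤ (equ t u) ρ π c = ≤-refl
ren-counter-≤ (neg φ) ρ π c = ren-counter-≤ φ ρ π c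
ren-counter-≤ (bin o φ ψ) ρ π c = ≤-trans (ren-counter-≤ φ ρ π c) (ren-counter-≤ ψ ρ π _)
ren-counter-≤ (qi Q y φ) ρ π c = ≤-trans (n≤1+n c) (ren-counter-≤ φ _ π (suc c))
ren-counter-≤ (qp Q q φ) ρ π c = ≤-trans (n≤1+n c) (ren-counter-≤ φ ρ _ (suc c))

evalT-renT : ∀ {D} (I J : Interp D) ρ → FunsAgree I J → ∀ t →
             (∀ z → OccT (si z) t → ind J z ≡ ind I (renI ρ z)) → evalT J t ≡ evalT I (renT ρ t)
evalTs-renTs : ∀ {D n} (I J : Interp D) ρ → FunsAgree I J → (ts : Vec Term n) →
               (∀ z → OccTs (si z) ts → ind J z ≡ ind I (renI ρ z)) → evalTs J ts ≡ evalTs I (renTs ρ ts)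
evalT-renT I J ρ fa (var y) h = h y (o-var refl)
evalT-renT I J ρ fa (app f ts) h =
  trans (fa f (evalTs J ts)) (cong (fun I f) (evalTs-renTs I J ρ fa ts (λ z o → h z (o-arg o))))
evalTs-renTs I J ρ fa [] h = refl
evalTs-renTs I J ρ fa (t ∷ ts) h =
  cong₂ _∷_ (evalT-renT I J ρ fa t (λ z o → h z (o-hd o))) (evalTs-renTs I J ρ fa ts (λ z o → h z (o-tl o)))

-- The counter c bounds the renamed free symbols, so the fresh names ys c and
-- psym _ c given to new binders cannot capture them.
record RenAgrees {D} (φ : Fm) (ρ : IRen) (π : PRen) (c : ℕ) (I J : Interp D) : Set where
  field
    ind-agree : ∀ z → FreeIn (si z) φ → ind J z ≡ ind I (renI ρ z)
    rel-agree : ∀ q → FreeIn (sp q) φ → ∀ v → rel J q v ⇔ rel I (renP π q) v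
    ind-below : ∀ z → FreeIn (si z) φ → yIdx (renI ρ z) ≤ c
    rel-below : ∀ q → FreeIn (sp q) φ → renNm π q < c

open RenAgrees

RenAgrees-sub : ∀ {D φ ψ ρ π c c'} {I J : Interp D} → (∀ s → FreeIn s ψ → FreeIn s φ) → c ≤ c' →
                RenAgrees φ ρ π c I J → RenAgrees ψ ρ π c' I J
RenAgrees-sub sub le a = record
  { ind-agree = λ z f → ind-agree a z (sub _ f)
  ; rel-agree = λ q f → rel-agree a q (sub _ f)
  ; ind-below = λ z f → ≤-trans (ind-below a z (sub _ f)) le
  ; rel-below = λ q f → ≤-trans (rel-below a q (sub _ f)) le
  }

RenAgrees-qi : ∀ {D Q y φ ρ π c} {I J : Interp D} → RenAgrees (qi Q y φ) ρ π c I J →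
               ∀ d → RenAgrees φ ((y , ys c) ∷ ρ) π (suc c) (updI I (ys c) d) (updI J y d)
RenAgrees-qi {Q = Q} {y} {φ} {ρ} {π} {c} {I} {J} a d = record
  { ind-agree = agree
  ; rel-agree = λ q f → rel-agree a q (f-qi (λ ()) f)
  ; ind-below = below
  ; rel-below = λ q f → ≤-trans (rel-below a q (f-qi (λ ()) f)) (n≤1+n c)
  }
  where
  agree : ∀ z → FreeIn (si z) φ → ind (updI J y d) z ≡ ind (updI I (ys c) d) (renI ((y , ys c) ∷ ρ) z)
  agree z f with z ≟I y
  ... | yes refl = sym (trans (cong (ind (updI I (ys c) d)) (renI-≡ y (ys c) ρ)) (updI-≡ I (ys c) d))
  ... | no z≢y = trans (ind-agree a z fz′)
                   (sym (trans (cong (ind (updI I (ys c) d)) (renI-≢ (ys c) ρ (λ e → z≢y (sym e))))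
                     (updI-≢ I d (λ e → 1+n≰n (≤-trans (≤-reflexive (cong yIdx (sym e))) (ind-below a z fz′))))))
    where
    fz′ = f-qi (λ e → z≢y (si-injective e)) f
  below : ∀ z → FreeIn (si z) φ → yIdx (renI ((y , ys c) ∷ ρ) z) ≤ suc c
  below z f with z ≟I y
  ... | yes refl = ≤-reflexive (cong yIdx (renI-≡ y (ys c) ρ))
  ... | no z≢y rewrite renI-≢ (ys c) ρ (λ e → z≢y (sym e)) =
    ≤-trans (ind-below a z (f-qi (λ e → z≢y (si-injective e)) f)) (n≤1+n c)

RenAgrees-qp : ∀ {D Q q φ ρ π c} {I J : Interp D} → RenAgrees (qp Q q φ) ρ π c I J →
               ∀ R → RenAgrees φ ρ ((q , c) ∷ π) (suc c) (updP I (psym (ar q) c) R) (updP J q R)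
RenAgrees-qp {Q = Q} {q} {φ} {ρ} {π} {c} {I} {J} a R = record
  { ind-agree = λ z f → ind-agree a z (f-qp (λ ()) f)
  ; rel-agree = agree
  ; ind-below = λ z f → ≤-trans (ind-below a z (f-qp (λ ()) f)) (n≤1+n c)
  ; rel-below = below
  }
  where
  agree : ∀ r → FreeIn (sp r) φ → ∀ v → updRel J q R r v ⇔ updRel I (psym (ar q) c) R (renP ((q , c) ∷ π) r) v
  agree r f v with r ≟P q
  ... | yes refl rewrite renNm-≡ q c π | updRel-≡ I (psym (ar q) c) R v = ⇔-id _
  ... | no r≢q = agree-≢ (f-qp (λ e → r≢q (sp-injective e)) f)
    where
    agree-≢ : FreeIn (sp r) (qp Q q φ) → rel J r v ⇔ updRel I (psym (ar q) c) R (renP ((q , c) ∷ π) r) v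
    agree-≢ fr rewrite renNm-≢ c π (λ e → r≢q (sym e))
                     | updRel-≢ I (psym (ar q) c) R (renP π r) v
                         (λ e → 1+n≰n (≤-trans (≤-reflexive (cong (λ x → suc (nm x)) (sym e))) (rel-below a r fr)))
                     = rel-agree a r fr v
  below : ∀ r → FreeIn (sp r) φ → renNm ((q , c) ∷ π) r < suc c
  below r f with r ≟P q
  ... | yes refl = ≤-reflexive (cong suc (renNm-≡ q c π))
  ... | no r≢q rewrite renNm-≢ c π (λ e → r≢q (sym e)) =
    ≤-trans (rel-below a r (f-qp (λ e → r≢q (sp-injective e)) f)) (n≤1+n c)

ren-correct : ∀ {D} φ ρ π c (I J : Interp D) → FunsAgree I J → RenAgrees φ ρ π c I J →
              ⟦ proj₁ (ren ρ π φ c) ⟧ I ⇔ ⟦ φ ⟧ J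
ren-correct top ρ π c I J fa a = ⇔-id _
ren-correct bot ρ π c I J fa a = ⇔-id _
ren-correct (atom q ts) ρ π c I J fa a
  rewrite evalTs-renTs I J ρ fa ts (λ z o → ind-agree a z (f-arg o)) =
  Lift-¬¬-cong-⇔ (⇔-sym (rel-agree a q (f-pred refl) _))
ren-correct (equ t u) ρ π c I J fa a
  rewrite evalT-renT I J ρ fa t (λ z o → ind-agree a z (f-eqˡ o))
        | evalT-renT I J ρ fa u (λ z o → ind-agree a z (f-eqʳ o)) = ⇔-id _
ren-correct (neg φ) ρ π c I J fa a = ¬-cong-⇔ (ren-correct φ ρ π c I J fa (RenAgrees-sub (λ _ → f-neg) ≤-refl a))
ren-correct (bin o φ ψ) ρ π c I J fa a =
  ⟦bin⟧-cong o (ren-correct φ ρ π c I J fa (RenAgrees-sub (λ _ → f-binˡ) ≤-refl a))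
               (ren-correct ψ ρ π _ I J fa (RenAgrees-sub (λ _ → f-binʳ) (ren-counter-≤ φ ρ π c) a))
ren-correct (qi Q y φ) ρ π c I J fa a =
  ⟦qi⟧-cong Q (λ d → ren-correct φ _ π (suc c) (updI I (ys c) d) (updI J y d) fa (RenAgrees-qi a d))
ren-correct (qp Q q φ) ρ π c I J fa a =
  ⟦qp⟧-cong Q (λ R → ren-correct φ ρ _ (suc c) (updP I (psym (ar q) c) R) (updP J q R) fa (RenAgrees-qp a R))

ren-[]-correct : ∀ {D} φ c → fresh φ ≤ c → (I : Interp D) → ⟦ proj₁ (ren [] [] φ c) ⟧ I ⇔ ⟦ φ ⟧ I
ren-[]-correct φ c le I = ren-correct φ [] [] c I I (λ _ _ → refl) record
  { ind-agree = λ _ _ → refl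
  ; rel-agree = λ _ _ _ → ⇔-id _
  ; ind-below = λ z f → ≤-trans (FreeIn-yIdx≤ z φ f) (≤-trans (m≤m⊔n _ _) le)
  ; rel-below = λ q f → ≤-trans (FreeIn-nm<maxP q φ f) (≤-trans (m≤n⊔m _ _) le)
  }

renSym : IRen → PRen → Sym → Sym
renSym ρ π (si y) = si (renI ρ y)
renSym ρ π (sf f) = sf f
renSym ρ π (sp q) = sp (renP π q)

renSym-[] : ∀ s → renSym [] [] s ≡ s
renSym-[] (si y) = refl
renSym-[] (sf f) = refl
renSym-[] (sp q) = refl

RenamedFrom : (Sym → Set) → IRen → PRen → Sym → Set
RenamedFrom P ρ π s = Σ Sym λ s₀ → P s₀ × s ≡ renSym ρ π s₀

OccT-renT : ∀ ρ π s t → OccT s (renT ρ t) → RenamedFrom (λ s₀ → OccT s₀ t) ρ π s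
OccTs-renTs : ∀ {n} ρ π s (ts : Vec Term n) → OccTs s (renTs ρ ts) → RenamedFrom (λ s₀ → OccTs s₀ ts) ρ π s
OccT-renT ρ π s (var y) (o-var e) = si y , o-var refl , e
OccT-renT ρ π s (app f ts) (o-fun e) = sf f , o-fun refl , e
OccT-renT ρ π s (app f ts) (o-arg o) with OccTs-renTs ρ π s ts o
... | s₀ , o₀ , e = s₀ , o-arg o₀ , e
OccTs-renTs ρ π s (t ∷ ts) (o-hd o) with OccT-renT ρ π s t o
... | s₀ , o₀ , e = s₀ , o-hd o₀ , e
OccTs-renTs ρ π s (t ∷ ts) (o-tl o) with OccTs-renTs ρ π s ts o
... | s₀ , o₀ , e = s₀ , o-tl o₀ , e

FreeIn-ren : ∀ φ ρ π c s → FreeIn s (proj₁ (ren ρ π φ c)) → RenamedFrom (λ s₀ → FreeIn s₀ φ) ρ π s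
FreeIn-ren (atom q ts) ρ π c s (f-pred e) = sp q , f-pred refl , e
FreeIn-ren (atom q ts) ρ π c s (f-arg o) with OccTs-renTs ρ π s ts o
... | s₀ , o₀ , e = s₀ , f-arg o₀ , e
FreeIn-ren (equ t u) ρ π c s (f-eqˡ o) with OccT-renT ρ π s t o
... | s₀ , o₀ , e = s₀ , f-eqˡ o₀ , e
FreeIn-ren (equ t u) ρ π c s (f-eqʳ o) with OccT-renT ρ π s u o
... | s₀ , o₀ , e = s₀ , f-eqʳ o₀ , e
FreeIn-ren (neg φ) ρ π c s (f-neg fr) with FreeIn-ren φ ρ π c s fr
... | s₀ , f₀ , e = s₀ , f-neg f₀ , e
FreeIn-ren (bin o φ ψ) ρ π c s (f-binˡ fr) with FreeIn-ren φ ρ π c s fr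
... | s₀ , f₀ , e = s₀ , f-binˡ f₀ , e
FreeIn-ren (bin o φ ψ) ρ π c s (f-binʳ fr) with FreeIn-ren ψ ρ π _ s fr
... | s₀ , f₀ , e = s₀ , f-binʳ f₀ , e
FreeIn-ren (qi Q y φ) ρ π c s (f-qi s≢ fr) with FreeIn-ren φ ((y , ys c) ∷ ρ) π (suc c) s fr
... | sf f , f₀ , e = sf f , f-qi (λ ()) f₀ , e
... | sp q , f₀ , e = sp q , f-qi (λ ()) f₀ , e
... | si z , f₀ , e with z ≟I y
...   | yes refl = ⊥-elim (s≢ (trans e (cong si (renI-≡ y (ys c) ρ))))
...   | no z≢y = si z , f-qi (λ e' → z≢y (si-injective e')) f₀ , trans e (cong si (renI-≢ (ys c) ρ (λ e' → z≢y (sym e'))))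
FreeIn-ren (qp Q q φ) ρ π c s (f-qp s≢ fr) with FreeIn-ren φ ρ ((q , c) ∷ π) (suc c) s fr
... | sf f , f₀ , e = sf f , f-qp (λ ()) f₀ , e
... | si z , f₀ , e = si z , f-qp (λ ()) f₀ , e
... | sp r , f₀ , e with r ≟P q
...   | yes refl = ⊥-elim (s≢ (trans e (cong (λ n → sp (psym (ar q) n)) (renNm-≡ q c π))))
...   | no r≢q = sp r , f-qp (λ e' → r≢q (sp-injective e')) f₀ ,
                 trans e (cong (λ n → sp (psym (ar r) n)) (renNm-≢ c π (λ e' → r≢q (sym e'))))

FreeIn-ren-[] : ∀ φ c s → FreeIn s (proj₁ (ren [] [] φ c)) → FreeIn s φ
FreeIn-ren-[] φ c s fr with FreeIn-ren φ [] [] c s fr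
... | s₀ , f₀ , e = subst (λ x → FreeIn x φ) (sym (trans e (renSym-[] s₀))) f₀

FreshName : ℕ → Sym → Set
FreshName c s = Σ ℕ λ c' → c ≤ c' × (s ≡ si (ys c') ⊎ Σ ℕ λ a → s ≡ sp (psym a c'))

Binds-ren : ∀ φ ρ π c s → Binds s (proj₁ (ren ρ π φ c)) → FreshName c s
Binds-ren (neg φ) ρ π c s (b-neg b) = Binds-ren φ ρ π c s b
Binds-ren (bin o φ ψ) ρ π c s (b-binˡ b) = Binds-ren φ ρ π c s b
Binds-ren (bin o φ ψ) ρ π c s (b-binʳ b) with Binds-ren ψ ρ π _ s b
... | c' , le , x = c' , ≤-trans (ren-counter-≤ φ ρ π c) le , x
Binds-ren (qi Q y φ) ρ π c s (b-qi-here e) = c , ≤-refl , inj₁ e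
Binds-ren (qi Q y φ) ρ π c s (b-qi-there b) with Binds-ren φ _ π (suc c) s b
... | c' , le , x = c' , ≤-trans (n≤1+n c) le , x
Binds-ren (qp Q q φ) ρ π c s (b-qp-here e) = c , ≤-refl , inj₂ (ar q , e)
Binds-ren (qp Q q φ) ρ π c s (b-qp-there b) with Binds-ren φ ρ _ (suc c) s b
... | c' , le , x = c' , ≤-trans (n≤1+n c) le , x

FreeIn-cleanVariant : ∀ φ s → FreeIn s (cleanVariant φ) → FreeIn s φ
FreeIn-cleanVariant φ = FreeIn-ren-[] φ (fresh φ)

cleanVariant-clean : ∀ φ → Clean (cleanVariant φ)
cleanVariant-clean φ s fr bs with Binds-ren φ [] [] (fresh φ) s bs
... | c' , le , inj₁ refl =
  1+n≰n (≤-trans (FreeIn-yIdx≤ (ys c') φ (FreeIn-cleanVariant φ _ fr)) (≤-trans (m≤m⊔n _ _) le))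
... | c' , le , inj₂ (a , refl) =
  1+n≰n (≤-trans (FreeIn-nm<maxP (psym a c') φ (FreeIn-cleanVariant φ _ fr)) (≤-trans (m≤n⊔m _ _) le))

psub-¬FreeIn : ∀ q H φ → ¬ FreeIn (sp q) φ → psub q H φ ≡ φ
psub-¬FreeIn q H top nf = refl
psub-¬FreeIn q H bot nf = refl
psub-¬FreeIn q H (atom r ts) nf with r ≟P q
... | yes refl = ⊥-elim (nf (f-pred refl))
... | no _ = refl
psub-¬FreeIn q H (equ t u) nf = refl
psub-¬FreeIn q H (neg φ) nf = cong neg (psub-¬FreeIn q H φ (λ f → nf (f-neg f)))
psub-¬FreeIn q H (bin o φ ψ) nf =
  cong₂ (bin o) (psub-¬FreeIn q H φ (λ f → nf (f-binˡ f))) (psub-¬FreeIn q H ψ (λ f → nf (f-binʳ f)))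
psub-¬FreeIn q H (qi Q y φ) nf = cong (qi Q y) (psub-¬FreeIn q H φ (λ f → nf (f-qi (λ ()) f)))
psub-¬FreeIn q H (qp Q r φ) nf with r ≟P q
... | yes _ = refl
... | no r≢q = cong (qp Q r) (psub-¬FreeIn q H φ (λ f → nf (f-qp (λ e → r≢q (sym (sp-injective e))) f)))

psub-atom-≡ : ∀ q T ts → psub q T (atom q ts) ≡ inst T ts
psub-atom-≡ q T ts rewrite ≟P-refl q = refl

psub-allVec : ∀ {n} q H (zs : Vec Ind n) φ → psub q H (allVec zs φ) ≡ allVec zs (psub q H φ)
psub-allVec q H [] φ = refl
psub-allVec q H (z ∷ zs) φ = cong (qi forallQ z) (psub-allVec q H zs φ)

FreeIn-sp-allVec : ∀ {n} q (zs : Vec Ind n) {φ} → FreeIn (sp q) φ → FreeIn (sp q) (allVec zs φ)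
FreeIn-sp-allVec q [] f = f
FreeIn-sp-allVec q (z ∷ zs) f = f-qi (λ ()) (FreeIn-sp-allVec q zs f)

FreeUnder-allVec : ∀ {n} q (zs : Vec Ind n) i {φ} → FreeIn (sp q) φ → FreeUnder (sp q) (si (lookup zs i)) (allVec zs φ)
FreeUnder-allVec q (z ∷ zs) fz f = u-qi-here (λ ()) refl (FreeIn-sp-allVec q zs f)
FreeUnder-allVec q (z ∷ zs) (fs i) f = u-qi-there (λ ()) (FreeUnder-allVec q zs i f)

SUBST-mono : ∀ {G G' p F} → (∀ s → FreeIn s G → FreeIn s G') → SUBST G' p F → SUBST G p F
SUBST-mono sub (capture , p∉ , xs∉) =
  (λ b f → capture b (sub b f)) , (λ f → p∉ (sub _ f)) , (λ j le f → xs∉ j le (sub _ f))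

SUBST-bin : ∀ {o φ ψ p F} → SUBST φ p F → SUBST ψ p F → SUBST (bin o φ ψ) p F
SUBST-bin (cφ , pφ , xφ) (cψ , pψ , xψ) =
  (λ b → λ { (f-binˡ f) → cφ b f ; (f-binʳ f) → cψ b f }) ,
  (λ { (f-binˡ f) → pφ f ; (f-binʳ f) → pψ f }) ,
  (λ j le → λ { (f-binˡ f) → xφ j le f ; (f-binʳ f) → xψ j le f })

Distinct : ∀ {n} → Vec Ind n → Set
Distinct zs = ∀ i j → lookup zs i ≡ lookup zs j → i ≡ j

updMany : ∀ {D n} → Interp D → Vec Ind n → Vec D n → Interp D
updMany I [] [] = I
updMany I (y ∷ zs) (d ∷ ds) = updMany (updI I y d) zs ds

updMany-fun : ∀ {D n} (I : Interp D) (zs : Vec Ind n) ds → FunsAgree I (updMany I zs ds)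
updMany-fun I [] [] f v = refl
updMany-fun I (y ∷ zs) (d ∷ ds) f v = updMany-fun (updI I y d) zs ds f v

updMany-rel : ∀ {D n} (I : Interp D) (zs : Vec Ind n) ds → ∀ q v → rel (updMany I zs ds) q v ≡ rel I q v
updMany-rel I [] [] q v = refl
updMany-rel I (y ∷ zs) (d ∷ ds) q v = updMany-rel (updI I y d) zs ds q v

updMany-funsAgree : ∀ {D n m} (I : Interp D) (zs : Vec Ind n) ds (zs' : Vec Ind m) ds' →
                    FunsAgree (updMany I zs ds) (updMany I zs' ds')
updMany-funsAgree I zs ds zs' ds' f v = trans (updMany-fun I zs' ds' f v) (sym (updMany-fun I zs ds f v))

updMany-relsAgree : ∀ {D n m} (I : Interp D) (zs : Vec Ind n) ds (zs' : Vec Ind m) ds' →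
                    RelsAgree (updMany I zs ds) (updMany I zs' ds')
updMany-relsAgree I zs ds zs' ds' q v rewrite updMany-rel I zs ds q v | updMany-rel I zs' ds' q v = ⇔-id _

updMany-∉ : ∀ {D n} (I : Interp D) (zs : Vec Ind n) ds z → (∀ i → z ≢ lookup zs i) →
            ind (updMany I zs ds) z ≡ ind I z
updMany-∉ I [] [] z z∉ = refl
updMany-∉ I (y ∷ zs) (d ∷ ds) z z∉ = trans (updMany-∉ (updI I y d) zs ds z (λ i → z∉ (fs i))) (updI-≢ I d (z∉ fz))

updMany-lookup : ∀ {D n} (I : Interp D) (zs : Vec Ind n) ds → Distinct zs → ∀ i →
                 ind (updMany I zs ds) (lookup zs i) ≡ lookup ds i
updMany-lookup I (y ∷ zs) (d ∷ ds) distinct fz =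
  trans (updMany-∉ (updI I y d) zs ds y (λ i e → fz≢fs (distinct fz (fs i) e))) (updI-≡ I y d)
  where
  fz≢fs : ∀ {n} {i : Fin n} → fz ≢ fs i
  fz≢fs ()
updMany-lookup I (y ∷ zs) (d ∷ ds) distinct (fs i) =
  updMany-lookup (updI I y d) zs ds (λ a b e → fs-injective (distinct (fs a) (fs b) e)) i
  where
  fs-injective : ∀ {n} {a b : Fin n} → fs a ≡ fs b → a ≡ b
  fs-injective refl = refl

xv : (k : ℕ) → Vec Ind k
xv k = tabulate (λ i → xs (toℕ i))

lookup-xv : ∀ {k} (i : Fin k) → lookup (xv k) i ≡ xs (toℕ i)
lookup-xv i = lookup∘tabulate (λ i → xs (toℕ i)) i

xv-distinct : ∀ k → Distinct (xv k)
xv-distinct k i j e = toℕ-injective (xs-injective (trans (sym (lookup-xv i)) (trans e (lookup-xv j))))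

xv-split : ∀ k z → (Σ (Fin k) λ i → z ≡ xs (toℕ i)) ⊎ (∀ (i : Fin k) → z ≢ xs (toℕ i))
xv-split k (ys n) = inj₂ (λ i ())
xv-split k (xs j) with j <? k
... | yes j<k = inj₁ (fromℕ< j<k , cong xs (sym (toℕ-fromℕ< j<k)))
... | no j≮k = inj₂ (λ i e → j≮k (subst (_< k) (sym (xs-injective e)) (toℕ<n i)))

lookupS-xsub-≡ : ∀ {n} m (ts : Vec Term n) i → lookupS (xsub m ts) (xs (m + toℕ i)) ≡ lookup ts i
lookupS-xsub-≡ m (t ∷ ts) fz rewrite +-identityʳ m = lookupS-∷-≡ (xs m) t (xsub (suc m) ts)
lookupS-xsub-≡ m (t ∷ ts) (fs i) rewrite +-suc m (toℕ i) =
  trans (lookupS-∷-≢ t (xsub (suc m) ts) (λ e → 1+n≰n (≤-trans (≤-reflexive (sym (xs-injective e))) (m≤m+n m (toℕ i)))))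
        (lookupS-xsub-≡ (suc m) ts i)

lookupS-xsub-∉ : ∀ {n} m (ts : Vec Term n) z → (∀ (i : Fin n) → z ≢ xs (m + toℕ i)) → lookupS (xsub m ts) z ≡ var z
lookupS-xsub-∉ m [] z z∉ = refl
lookupS-xsub-∉ {suc n} m (t ∷ ts) z z∉ =
  trans (lookupS-∷-≢ t (xsub (suc m) ts) (λ e → z∉ (fz {n}) (trans (sym e) (cong xs (sym (+-identityʳ m))))))
        (lookupS-xsub-∉ (suc m) ts z (λ (i : Fin n) e → z∉ (fs i) (trans e (cong xs (sym (+-suc m (toℕ i)))))))

inst-correct : ∀ {D k} (C : Fm) (zs : Vec Ind k) → Distinct zs → (∀ i → ¬ FreeIn (si (lookup zs i)) C) →
               (I : Interp D) (ds : Vec D k) →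
               ⟦ inst C (vmap var zs) ⟧ (updMany I zs ds) ⇔ ⟦ C ⟧ (updMany I (xv k) ds)
inst-correct {D} {k} C zs distinct zs∉C I ds =
  substF-correct C (xsub 0 (vmap var zs)) (updMany I zs ds) (updMany I (xv k) ds)
    (updMany-funsAgree I zs ds (xv k) ds) (updMany-relsAgree I zs ds (xv k) ds) agree
  where
  agree : SubstAgrees C (xsub 0 (vmap var zs)) (updMany I zs ds) (updMany I (xv k) ds)
  agree z fr with xv-split k z
  ... | inj₁ (i , refl) rewrite lookupS-xsub-≡ 0 (vmap var zs) i | lookup-map i var zs =
    trans (trans (cong (ind (updMany I (xv k) ds)) (sym (lookup-xv i))) (updMany-lookup I (xv k) ds (xv-distinct k) i))
          (sym (updMany-lookup I zs ds distinct i))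
  ... | inj₂ z∉ rewrite lookupS-xsub-∉ 0 (vmap var zs) z z∉ =
    trans (updMany-∉ I (xv k) ds z (λ i e → z∉ i (trans e (lookup-xv i))))
          (sym (updMany-∉ I zs ds z (λ i e → zs∉C i (subst (λ w → FreeIn (si w) C) e fr))))

inst-xbar : ∀ {D} T k (I : Interp D) → ⟦ inst T (xbar k) ⟧ I ⇔ ⟦ T ⟧ I
inst-xbar T k I = substF-correct T (xsub 0 (xbar k)) I I (λ _ _ → refl) (λ _ _ → ⇔-id _) agree
  where
  agree : SubstAgrees T (xsub 0 (xbar k)) I I
  agree z _ with xv-split k z
  ... | inj₁ (i , refl) rewrite lookupS-xsub-≡ 0 (xbar k) i | lookup∘tabulate (λ i → var (xs (toℕ i))) i = refl
  ... | inj₂ z∉ rewrite lookupS-xsub-∉ 0 (xbar k) z z∉ = refl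

⟦allVec⟧ : ∀ {D n} (zs : Vec Ind n) φ (I : Interp D) → ⟦ allVec zs φ ⟧ I ⇔ ((ds : Vec D n) → ⟦ φ ⟧ (updMany I zs ds))
⟦allVec⟧ [] φ I = mk⇔ (λ x → λ { [] → x }) (λ f → f [])
⟦allVec⟧ (z ∷ zs) φ I = mk⇔
  (λ x → λ { (d ∷ ds) → to (⟦allVec⟧ zs φ (updI I z d)) (x d) ds })
  (λ f d → from (⟦allVec⟧ zs φ (updI I z d)) (λ ds → f (d ∷ ds)))

xvals : ∀ {D} k → Interp D → Vec D k
xvals k I = tabulate (λ i → ind I (xs (toℕ i)))

updMany-xvals : ∀ {D} k (I : Interp D) φ → ⟦ φ ⟧ (updMany I (xv k) (xvals k I)) ⇔ ⟦ φ ⟧ I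
updMany-xvals k I φ =
  ⟦⟧-coincidence φ (updMany I (xv k) (xvals k I)) I (updMany-funsAgree _ (xv k) (xvals k I) [] [])
    (updMany-relsAgree I (xv k) (xvals k I) [] []) agree
  where
  agree : ∀ z → FreeIn (si z) φ → ind I z ≡ ind (updMany I (xv k) (xvals k I)) z
  agree z _ with xv-split k z
  ... | inj₁ (i , refl) = sym (begin
    ind (updMany I (xv k) (xvals k I)) (xs (toℕ i))   ≡⟨ cong (ind (updMany I (xv k) (xvals k I))) (sym (lookup-xv i)) ⟩
    ind (updMany I (xv k) (xvals k I)) (lookup (xv k) i) ≡⟨ updMany-lookup I (xv k) (xvals k I) (xv-distinct k) i ⟩
    lookup (xvals k I) i                                ≡⟨ lookup∘tabulate (λ i → ind I (xs (toℕ i))) i ⟩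
    ind I (xs (toℕ i))                                  ∎)
    where open ≡-Reasoning
  ... | inj₂ z∉ = sym (updMany-∉ I (xv k) (xvals k I) z (λ i e → z∉ i (trans e (lookup-xv i))))

infix 4 _⊨_
_⊨_ : Fm → Fm → Set₁
φ ⊨ ψ = ∀ D (I : Interp D) → ⟦ φ ⟧ I → ⟦ ψ ⟧ I

⊨-trans : ∀ {φ ψ χ} → φ ⊨ ψ → ψ ⊨ χ → φ ⊨ χ
⊨-trans f g D I x = g D I (f D I x)

≃F-sym : ∀ {φ ψ} → φ ≃F ψ → ψ ≃F φ
≃F-sym e D I = proj₂ (e D I) , proj₁ (e D I)

≃F-trans : ∀ {φ ψ χ} → φ ≃F ψ → ψ ≃F χ → φ ≃F χ
≃F-trans e f D I = (λ x → proj₁ (f D I) (proj₁ (e D I) x)) , (λ x → proj₂ (e D I) (proj₂ (f D I) x))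

⇔⇒≃F : ∀ {φ ψ} → (∀ {D} (I : Interp D) → ⟦ φ ⟧ I ⇔ ⟦ ψ ⟧ I) → φ ≃F ψ
⇔⇒≃F e D I = to (e I) , from (e I)

⊨-∨-∧ˡ : ∀ A B T → A ⊨ bin orOp A (bin andOp B T)
⊨-∨-∧ˡ A B T D I a k = k (inj₁ a)

∨-∧-⊨ : ∀ {A B} T → A ⊨ B → bin orOp A (bin andOp B T) ⊨ B
∨-∧-⊨ {B = B} T A⊨B D I x = ⟦⟧-stable B I (λ ¬b → x [ (λ a → ¬b (A⊨B D I a)) , (λ bt → ¬b (proj₁ bt)) ])

between-≃-∨-∧ : ∀ {A B H} → A ⊨ H → H ⊨ B → H ≃F bin orOp A (bin andOp B H)
between-≃-∨-∧ {H = H} A⊨H H⊨B D I =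
  (λ h k → k (inj₂ (H⊨B D I h , h))) ,
  (λ x → ⟦⟧-stable H I (λ ¬h → x [ (λ a → ¬h (A⊨H D I a)) , (λ bh → ¬h (proj₂ bh)) ]))

between-resp-≃ : ∀ {A B H K} → H ≃F K → A ⊨ K → K ⊨ B → A ⊨ H × H ⊨ B
between-resp-≃ H≃K A⊨K K⊨B =
  (λ D I a → proj₂ (H≃K D I) (A⊨K D I a)) , (λ D I h → K⊨B D I (proj₁ (H≃K D I) h))

module Sandwich (p : PSym) (ȳ : Vec Ind (ar p)) (ȳ-distinct : Distinct ȳ) (A B : Fm)
                (SA : SUBST A p (Fsandwich p ȳ A B)) (SB : SUBST B p (Fsandwich p ȳ A B)) where

  F : Fm
  F = Fsandwich p ȳ A B

  ȳv : Vec Term (ar p)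
  ȳv = vmap var ȳ

  -- ȳ binds the occurrences of p in F, so SUBST keeps ȳ out of free(C).
  ȳ∉ : ∀ {C} → SUBST C p F → ∀ i → ¬ FreeIn (si (lookup ȳ i)) C
  ȳ∉ (capture , _) i f = capture (si (lookup ȳ i)) f
    (u-binˡ (FreeUnder-allVec p ȳ i (f-binʳ (f-pred refl))))

  FreeIn-sp-A⇒F : ∀ {q} → FreeIn (sp q) A → FreeIn (sp q) F
  FreeIn-sp-A⇒F f = f-binˡ (FreeIn-sp-allVec _ ȳ (f-binˡ (FreeIn-sp-substF⁺ _ A _ f)))

  FreeIn-sp-B⇒F : ∀ {q} → FreeIn (sp q) B → FreeIn (sp q) F
  FreeIn-sp-B⇒F f = f-binʳ (FreeIn-sp-allVec _ ȳ (f-binʳ (FreeIn-sp-substF⁺ _ B _ f)))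

  psub-F : ∀ C → psub p C F ≡ bin andOp (allVec ȳ (bin impOp (inst A ȳv) (inst C ȳv)))
                                         (allVec ȳ (bin impOp (inst C ȳv) (inst B ȳv)))
  psub-F C
    rewrite psub-allVec p C ȳ (bin impOp (inst A ȳv) (atom p ȳv))
          | psub-allVec p C ȳ (bin impOp (atom p ȳv) (inst B ȳv))
          | ≟P-refl p
          | psub-¬FreeIn p C (inst A ȳv) (λ f → proj₁ (proj₂ SA) (FreeIn-sp-substF⁻ p A _ f))
          | psub-¬FreeIn p C (inst B ȳv) (λ f → proj₁ (proj₂ SB) (FreeIn-sp-substF⁻ p B _ f)) = refl

  ⟦∀ȳ→⟧ : ∀ {C C'} → SUBST C p F → SUBST C' p F → ∀ {D} (I : Interp D) →
          ⟦ allVec ȳ (bin impOp (inst C ȳv) (inst C' ȳv)) ⟧ I ⇔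
          ((ds : Vec D (ar p)) → ⟦ C ⟧ (updMany I (xv (ar p)) ds) → ⟦ C' ⟧ (updMany I (xv (ar p)) ds))
  ⟦∀ȳ→⟧ {C} {C'} SC SC' I = Π-cong-⇔ (λ ds →
    →-cong-⇔ (inst-correct C ȳ ȳ-distinct (ȳ∉ SC) I ds) (inst-correct C' ȳ ȳ-distinct (ȳ∉ SC') I ds))
    ⇔-∘ ⟦allVec⟧ ȳ _ I

  -- Instantiating ȳ by the values of x̄ in I recovers I itself.
  ⊨-from-updMany : ∀ {C C'} → (∀ D (I : Interp D) (ds : Vec D (ar p)) → ⟦ C ⟧ (updMany I (xv (ar p)) ds) → ⟦ C' ⟧ (updMany I (xv (ar p)) ds)) →
         C ⊨ C'
  ⊨-from-updMany {C} {C'} h D I c = to (updMany-xvals (ar p) I C') (h D I (xvals (ar p) I) (from (updMany-xvals (ar p) I C) c))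

  valid⇔between : ∀ C → SUBST C p F → Valid (psub p C F) ⇔ (A ⊨ C × C ⊨ B)
  valid⇔between C SC = subst (λ φ → Valid φ ⇔ (A ⊨ C × C ⊨ B)) (sym (psub-F C)) (mk⇔
    (λ v → ⊨-from-updMany (λ D I → to (⟦∀ȳ→⟧ SA SC I) (proj₁ (v D I))) , ⊨-from-updMany (λ D I → to (⟦∀ȳ→⟧ SC SB I) (proj₂ (v D I))))
    (λ { (A⊨C , C⊨B) D I → from (⟦∀ȳ→⟧ SA SC I) (λ ds → A⊨C D _) , from (⟦∀ȳ→⟧ SC SB I) (λ ds → C⊨B D _) }))

module CleanOrAnd (A B : Fm) (t : PSym) (t∉A : ¬ FreeIn (sp t) A) (t∉B : ¬ FreeIn (sp t) B) where

  tx : Fm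
  tx = atom t (xbar (ar t))

  G₀ : Fm
  G₀ = bin orOp A (bin andOp B tx)

  G : Fm
  G = cleanVariant G₀

  private
    c₀ = fresh G₀
    A' = proj₁ (ren [] [] A c₀)
    c₁ = proj₂ (ren [] [] A c₀)
    B' = proj₁ (ren [] [] B c₁)

    psub-G : ∀ T → psub t T G ≡ bin orOp A' (bin andOp B' (inst T (xbar (ar t))))
    psub-G T = cong₂ (bin orOp) (psub-¬FreeIn t T A' (λ f → t∉A (FreeIn-ren-[] A c₀ _ f)))
                 (cong₂ (bin andOp) (psub-¬FreeIn t T B' (λ f → t∉B (FreeIn-ren-[] B c₁ _ f)))
                   (trans (psub-atom-≡ t T _) (cong (inst T) (renTs-[] (xbar (ar t))))))

    fresh-A : fresh A ≤ c₀
    fresh-A = fresh-binˡ orOp A (bin andOp B tx)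

    fresh-B : fresh B ≤ c₁
    fresh-B = ≤-trans (≤-trans (fresh-binˡ andOp B tx) (fresh-binʳ orOp A (bin andOp B tx))) (ren-counter-≤ A [] [] c₀)

  A∨B∧ : Fm → Fm
  A∨B∧ T = bin orOp A (bin andOp B T)

  psub-cleanVariant-≃ : ∀ T → psub t T G ≃F A∨B∧ T
  psub-cleanVariant-≃ T = ⇔⇒≃F {psub t T G} {A∨B∧ T} λ I → subst (λ φ → ⟦ φ ⟧ I ⇔ ⟦ A∨B∧ T ⟧ I) (sym (psub-G T))
    (⟦bin⟧-cong orOp {A} {A'} {bin andOp B T} (ren-[]-correct A c₀ fresh-A I)
      (⟦bin⟧-cong andOp {B} {B'} {T} (ren-[]-correct B c₁ fresh-B I) (inst-xbar T (ar t) I)))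

  instance-between : A ⊨ B → ∀ {H} T → H ≃F psub t T G → A ⊨ H × H ⊨ B
  instance-between A⊨B {H} T H≃G[T] =
    between-resp-≃ {K = A∨B∧ T} (≃F-trans {H} {psub t T G} {A∨B∧ T} H≃G[T] (psub-cleanVariant-≃ T))
      (⊨-∨-∧ˡ A B T) (∨-∧-⊨ T A⊨B)

  between-≃-instance : ∀ {H} → A ⊨ H → H ⊨ B → H ≃F psub t H G
  between-≃-instance {H} A⊨H H⊨B =
    ≃F-trans {H} {A∨B∧ H} {psub t H G} (between-≃-∨-∧ A⊨H H⊨B) (≃F-sym {psub t H G} {A∨B∧ H} (psub-cleanVariant-≃ H))

-- Neither are
-- ar t ≡ ar p and t ≢ p.
proposition15 : (p : PSym) (ȳ : Vec Ind (ar p)) →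
    (∀ i j → lookup ȳ i ≡ lookup ȳ j → i ≡ j) →
    (∀ i → NotX (lookup ȳ i)) →
    (A B : Fm) (t : PSym) →
    ReprProblem (Fsandwich p ȳ A B) p t →
    HasSolution (Fsandwich p ȳ A B) p →
    SUBST A p (Fsandwich p ȳ A B) →
    SUBST B p (Fsandwich p ȳ A B) →
    SUBST (atom t (xbar (ar t))) p (Fsandwich p ȳ A B) →
    ReproductiveSolution (Fsandwich p ȳ A B) p t
    (cleanVariant (bin orOp A (bin andOp B (atom t (xbar (ar t))))))
proposition15 p ȳ ȳ-distinct _ A B t (_ , t∉F , _) (S , SUBST-S , valid-S) SA SB St =
  (cleanVariant-clean G₀ , SUBST-G , parametric) , reproductive
  where
  open Sandwich p ȳ ȳ-distinct A B SA SB
  open CleanOrAnd A B t (λ f → t∉F (FreeIn-sp-A⇒F f)) (λ f → t∉F (FreeIn-sp-B⇒F f))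

  A⊨B : A ⊨ B
  A⊨B = let (A⊨S , S⊨B) = to (valid⇔between S SUBST-S) valid-S in ⊨-trans {ψ = S} A⊨S S⊨B

  SUBST-G : SUBST G p F
  SUBST-G = SUBST-mono (FreeIn-cleanVariant G₀) (SUBST-bin SA (SUBST-bin SB St))

  parametric : ∀ H → SUBST H t G → SUBST H p F →
               Σ Fm (λ T → SUBST T t G × SUBST (psub t T G) p F × (H ≃F psub t T G)) → Valid (psub p H F)
  parametric H _ SH (T , _ , _ , H≃G[T]) = from (valid⇔between H SH) (instance-between A⊨B T H≃G[T])

  reproductive : ∀ H → SUBST H t G → SUBST H p F → Valid (psub p H F) → H ≃F psub t H G
  reproductive H _ SH valid-H = let (A⊨H , H⊨B) = to (valid⇔between H SH) valid-H in between-≃-instance A⊨H H⊨B
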